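{- Let $\Gamma=(D,A,B)$ be a web (satisfying the standing assumptions below), let $\mathcal W$ be a wave in $\Gamma$ and let $W\in\mathcal W$. Then $W$ is essential in $\mathcal W$ if and only if $\mathcal W\setminus\{W\}$ is not a wave.
   Context: A web is $\Gamma=(D,A,B)$, $D$ a digraph, $A,B\subseteq V(D)$. Standing assumptions: no edge has head in $A$ or tail in $B$; every vertex of $A$ can reach $B$. Paths are simple directed paths with initial vertex $in(P)$, finite (terminal vertex $ter(P)$) or one-way infinite; single vertices are paths. A warp is a set of pairwise vertex-disjoint paths; $in[\mathcal W]$ is the set of initial vertices, $ter[\mathcal W]$ the set of terminal vertices of finite paths. A wave is a warp $\mathcal W$ with $in[\mathcal W]\subseteq A$ such that every finite path from $A$ to $B$ meets $ter[\mathcal W]$. For $S\subseteq V(D)$, $\mathcal E(S)$ is the set of $s\in S$ for which there is a path from $s$ to a vertex of $B$ containing no vertex of $S$ other than $s$. A path $W$ of a warp $\mathcal W$ is essential in $\mathcal W$ if $W$ is finite and $ter(W)\in\mathcal E(ter[\mathcal W])$. -}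

module Defs where

open import Data.Nat using (ℕ; suc)
open import Data.List using (List; _∷_)
open import Data.List.NonEmpty using (List⁺; _∷_; head; last; toList)
open import Data.List.Membership.Propositional using (_∈_)
open import Data.List.Relation.Unary.Linked using (Linked)
open import Data.List.Relation.Unary.Unique.Propositional using (Unique)
open import Data.Product using (Σ; _×_; _,_; ∃; proj₁)
open import Data.Sum using (_⊎_; inj₁; inj₂)
open import Data.Empty using (⊥)
open import Relation.Nullary using (¬_)
open import Relation.Binary.PropositionalEquality using (_≡_; _≢_)
open import Function.Definitions using (Injective)

module _ {V : Set} (E : V → V → Set) where

  record FinPath : Set where
    constructor finPath
    field
      verts  : List⁺ V
      linked : Linked E (toList verts)
      simple : Unique (toList verts)

  open FinPath public

  inF : FinPath → V
  inF p = head (verts p)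

  terF : FinPath → V
  terF p = last (verts p)

  OnFin : V → FinPath → Set
  OnFin v p = v ∈ toList (verts p)

  record InfPath : Set where
    constructor infPath
    field
      seq    : ℕ → V
      edges  : ∀ n → E (seq n) (seq (suc n))
      inj    : Injective _≡_ _≡_ seq

  open InfPath public

  Path : Set
  Path = FinPath ⊎ InfPath

  inP : Path → V
  inP (inj₁ p) = inF p
  inP (inj₂ q) = seq q 0

  OnPath : V → Path → Set
  OnPath v (inj₁ p) = OnFin v p
  OnPath v (inj₂ q) = ∃ λ n → seq q n ≡ v

  TerIs : Path → V → Set
  TerIs (inj₁ p) v = terF p ≡ v
  TerIs (inj₂ q) v = ⊥

  -- An indexed family of paths (the index type plays the role of the set).
  record Family : Set₁ where
    constructor family
    field
      Idx  : Set
      path : Idx → Path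

  open Family public

  IsWarp : Family → Set
  IsWarp 𝒲 = ∀ i j → i ≢ j → ∀ v → OnPath v (path 𝒲 i) → OnPath v (path 𝒲 j) → ⊥

  inSet : Family → V → Set
  inSet 𝒲 v = Σ (Idx 𝒲) λ i → inP (path 𝒲 i) ≡ v

  terSet : Family → V → Set
  terSet 𝒲 v = Σ (Idx 𝒲) λ i → TerIs (path 𝒲 i) v

  -- 𝒲 ∖ {W_i}
  -- indices of 𝒲 other than i (the inequality proof is irrelevant, so this
  -- is exactly the subset {j | j ≠ i})
  record Other (𝒲 : Family) (i : Idx 𝒲) : Set where
    constructor other
    field
      idx  : Idx 𝒲
      .ne  : idx ≢ i

  removeW : (𝒲 : Family) → Idx 𝒲 → Family
  removeW 𝒲 i = family (Other 𝒲 i) (λ o → path 𝒲 (Other.idx o))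

  module _ (A B : V → Set) where

    ABPath : FinPath → Set
    ABPath p = A (inF p) × B (terF p)

    IsWave : Family → Set
    IsWave 𝒲 = IsWarp 𝒲
             × (∀ v → inSet 𝒲 v → A v)
             × (∀ p → ABPath p → ∃ λ v → OnFin v p × terSet 𝒲 v)

    𝓔 : (V → Set) → V → Set
    𝓔 S s = S s × (∃ λ p → inF p ≡ s × B (terF p) × (∀ v → OnFin v p → S v → v ≡ s))

    Essential : (𝒲 : Family) → Idx 𝒲 → Set
    Essential 𝒲 i = ∃ λ v → TerIs (path 𝒲 i) v × 𝓔 (terSet 𝒲) v

record Web : Set₁ where
  field
    V : Set
    E : V → V → Set
    A : V → Set
    B : V → Set
    noHeadInA : ∀ u v → E u v → ¬ A v
    noTailInB : ∀ u v → E u v → ¬ B u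
    AreachesB : ∀ a → A a → ∃ λ (p : FinPath E) → inF E p ≡ a × B (terF E p)

private
  module _ {V : Set} {E : V → V → Set} (𝒲 : Family E) (i : Idx 𝒲) where
    open import Relation.Binary.PropositionalEquality using (refl)
    otherEq : (a b : Other E 𝒲 i) → Other.idx a ≡ Other.idx b → a ≡ b
    otherEq a b refl = refl

-- If W is essential, witnessed by a path P from ter(W) to B that meets ter[𝒲] only at
-- ter(W), then the walk W·P contains a simple A–B path whose vertices lie on W or on P.
-- A path of 𝒲 ∖ {W} ending on it would end on W or at ter(W), contradicting disjointness.
-- Conversely, an A–B path missed by ter[𝒲 ∖ {W}] still meets ter[𝒲], hence at ter(W),
-- and its tail from there witnesses that W is essential.  Excluded middle is used to
-- shortcut walks to paths and to extract such an A–B path from the failure of the wave property.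
module Submission where

open import Defs
open import Level using (0ℓ)
open import Axiom.ExcludedMiddle using (ExcludedMiddle)
open import Relation.Nullary using (¬_)
open import Function.Bundles using (_⇔_)

open import Function.Base using (_∘_)
open import Function.Bundles using (mk⇔)
open import Data.List.Base using (List; []; _∷_; _++_; initLast; _∷ʳ′_)
open import Data.List.NonEmpty using (_∷_; last; toList)
open import Data.List.Relation.Unary.Linked using (Linked; [-]; _∷_)
open import Data.List.Relation.Unary.AllPairs using ([]; _∷_)
open import Data.List.Relation.Unary.All using ([])
open import Data.List.Relation.Unary.All.Properties using (¬Any⇒All¬)
open import Data.List.Relation.Unary.Any using (here; there)
open import Data.List.Membership.Propositional using (_∈_)
open import Data.List.Membership.Propositional.Properties using (∈-++⁻)
open import Data.Product using (Σ; _×_; _,_; ∃)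
open import Data.Sum using (_⊎_; inj₁; inj₂; [_,_])
import Data.Sum as Sum
open import Data.Empty using (⊥-elim)
import Data.Empty.Irrelevant as Irrelevant
open import Relation.Nullary using (yes; no)
open import Relation.Nullary.Decidable using (decidable-stable)
open import Relation.Binary.Definitions using (DecidableEquality)
open import Relation.Binary.PropositionalEquality using (_≡_; _≢_; refl; sym; trans; cong; subst)

module _ {V : Set} where

  last-∷ : (x y : V) (ys : List V) → last (x ∷ y ∷ ys) ≡ last (y ∷ ys)
  last-∷ x y ys with initLast ys
  ... | []       = refl
  ... | _ ∷ʳ′ _  = refl

  last-∈ : (x : V) (xs : List V) → last (x ∷ xs) ∈ x ∷ xs
  last-∈ x []       = here refl
  last-∈ x (y ∷ ys) = there (subst (_∈ y ∷ ys) (sym (last-∷ x y ys)) (last-∈ y ys))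

  last-++ : ∀ {a c} (as cs : List V) → last (a ∷ as) ≡ c → last (a ∷ as ++ cs) ≡ last (c ∷ cs)
  last-++ []       cs refl = refl
  last-++ {a} (b ∷ bs) cs eq = trans (last-∷ a b (bs ++ cs)) (last-++ bs cs (trans (sym (last-∷ a b bs)) eq))

module Paths {V : Set} (E : V → V → Set) where

  record PathWithin (S : V → Set) (a b : V) : Set where
    constructor pathWithin
    field
      route  : FinPath E
      starts : inF E route ≡ a
      ends   : terF E route ≡ b
      inside : ∀ v → OnFin E v route → S v

  open PathWithin public

  ++-linked : ∀ {a c} (as cs : List V) → Linked E (a ∷ as) → last (a ∷ as) ≡ c →
              Linked E (c ∷ cs) → Linked E (a ∷ as ++ cs)
  ++-linked []       cs [-]      refl lc = lc
  ++-linked {a} (b ∷ bs) cs (e ∷ la) eq lc = e ∷ ++-linked bs cs la (trans (sym (last-∷ a b bs)) eq) lc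

  weaken : ∀ {S T : V → Set} {a b} → (∀ {v} → S v → T v) → PathWithin S a b → PathWithin T a b
  weaken f (pathWithin p starts ends inside) = pathWithin p starts ends (λ v → f ∘ inside v)

  whole : (p : FinPath E) → PathWithin (λ v → OnFin E v p) (inF E p) (terF E p)
  whole p = pathWithin p refl refl (λ _ v∈p → v∈p)

  suffix : ∀ {S a b x} (r : PathWithin S a b) → OnFin E x (route r) → PathWithin S x b
  suffix r@(pathWithin _ refl _ _) (here refl) = r
  suffix (pathWithin (finPath (c ∷ []) _ _) refl _ _) (there ())
  suffix (pathWithin (finPath (c ∷ d ∷ ds) (_ ∷ lk) (_ ∷ u)) refl ends inside) (there x∈r) =
    suffix (pathWithin (finPath (d ∷ ds) lk u) refl (trans (sym (last-∷ c d ds)) ends) (λ v → inside v ∘ there)) x∈r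

  prepend : ∀ {S x a b} → E x a → (r : PathWithin S a b) → ¬ OnFin E x (route r) →
            PathWithin (λ v → v ≡ x ⊎ S v) x b
  prepend {x = x} e (pathWithin (finPath (a ∷ as) lk u) refl ends inside) x∉r =
    pathWithin (finPath (x ∷ a ∷ as) (e ∷ lk) (¬Any⇒All¬ (a ∷ as) x∉r ∷ u)) refl
      (trans (last-∷ x a as) ends)
      λ { v (here v≡x) → inj₁ v≡x ; v (there v∈r) → inj₂ (inside v v∈r) }

  module _ (_≟_ : DecidableEquality V) where
    open import Data.List.Membership.DecPropositional _≟_ using (_∈?_)

    -- A repeated vertex is removed by cutting the loop it closes.
    cons : ∀ {S x a b} → E x a → PathWithin S a b → PathWithin (λ v → v ≡ x ⊎ S v) x b
    cons {x = x} e r with x ∈? toList (verts (route r))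
    ... | yes x∈r = weaken inj₂ (suffix r x∈r)
    ... | no  x∉r = prepend e r x∉r

    shortcut : ∀ {x} xs → Linked E (x ∷ xs) → PathWithin (_∈ x ∷ xs) x (last (x ∷ xs))
    shortcut {x} []       [-]      = pathWithin (finPath (x ∷ []) [-] ([] ∷ [])) refl refl (λ _ v∈x → v∈x)
    shortcut {x} (y ∷ ys) (e ∷ lk) =
      weaken [ here , there ] (subst (PathWithin _ x) (sym (last-∷ x y ys)) (cons e (shortcut ys lk)))

    join : (q p : FinPath E) → terF E q ≡ inF E p →
           PathWithin (λ v → OnFin E v q ⊎ OnFin E v p) (inF E q) (terF E p)
    join (finPath (a ∷ as) lq _) (finPath (c ∷ cs) lp _) q→p =
      weaken (Sum.map₂ there ∘ ∈-++⁻ (a ∷ as))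
        (subst (PathWithin _ a) (last-++ as cs q→p) (shortcut (as ++ cs) (++-linked as cs lq q→p lp)))

module _ {V : Set} {E : V → V → Set} where

  TerIs⇒OnPath : ∀ P {v} → TerIs E P v → OnPath E v P
  TerIs⇒OnPath (inj₁ (finPath (x ∷ xs) _ _)) refl = last-∈ x xs

  TerIs-functional : ∀ P {v w} → TerIs E P v → TerIs E P w → v ≡ w
  TerIs-functional (inj₁ _) refl refl = refl

  TerIs⇒finite : ∀ P {v} → TerIs E P v → Σ (FinPath E) λ q → P ≡ inj₁ q × terF E q ≡ v
  TerIs⇒finite (inj₁ q) ter = q , refl , ter

module WaveRemoval {V : Set} (E : V → V → Set) (A B : V → Set) (𝒲 : Family E) (i : Idx 𝒲) where
  open Paths E

  other-≢ : (o : Other E 𝒲 i) → Other.idx o ≢ i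
  other-≢ (other j j≢i) j≡i = Irrelevant.⊥-elim (j≢i j≡i)

  removeW-warp : IsWarp E 𝒲 → IsWarp E (removeW E 𝒲 i)
  removeW-warp warp (other j _) (other k _) o≢o′ = warp j k λ { refl → o≢o′ refl }

  removeW-in : (∀ v → inSet E 𝒲 v → A v) → ∀ v → inSet E (removeW E 𝒲 i) v → A v
  removeW-in inA v (other j _ , in≡v) = inA v (j , in≡v)

  terSet-removeW : DecidableEquality (Idx 𝒲) → ∀ {v} → terSet E 𝒲 v →
                   TerIs E (path 𝒲 i) v ⊎ terSet E (removeW E 𝒲 i) v
  terSet-removeW _≟_ (j , ter) with j ≟ i
  ... | yes refl = inj₁ ter
  ... | no  j≢i  = inj₂ (other j j≢i , ter)

  essential⇒¬wave : DecidableEquality V → IsWave E A B 𝒲 → Essential E A B 𝒲 i →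
                    ¬ IsWave E A B (removeW E 𝒲 i)
  essential⇒¬wave _≟_ (warp , inA , _) (v , ter-Wᵢ , _ , p , p-in , p-B , only-v) (_ , _ , cover)
    with q , Wᵢ≡q , ter-q ← TerIs⇒finite (path 𝒲 i) ter-Wᵢ
    with r ← join _≟_ q p (trans ter-q (sym p-in))
    with u , u∈r , o@(other j _) , ter-Wⱼ ←
           cover (route r) (subst A (sym (starts r)) (inA _ (i , cong (inP E) Wᵢ≡q)) ,
                            subst B (sym (ends r)) p-B)
    = warp i j (other-≢ o ∘ sym) u ([ on-q , on-p ] (inside r u u∈r)) (TerIs⇒OnPath (path 𝒲 j) ter-Wⱼ)
    where
    on-q : OnFin E u q → OnPath E u (path 𝒲 i)
    on-q = subst (OnPath E u) (sym Wᵢ≡q)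

    on-p : OnFin E u p → OnPath E u (path 𝒲 i)
    on-p u∈p = subst (λ w → OnPath E w (path 𝒲 i)) (sym (only-v u u∈p (j , ter-Wⱼ)))
                 (TerIs⇒OnPath (path 𝒲 i) ter-Wᵢ)

  uncovered⇒essential : DecidableEquality (Idx 𝒲) → IsWave E A B 𝒲 → (p : FinPath E) → ABPath E A B p →
                        ¬ (∃ λ u → OnFin E u p × terSet E (removeW E 𝒲 i) u) → Essential E A B 𝒲 i
  uncovered⇒essential _≟_ (_ , _ , cover) p ab@(_ , p-B) uncovered
    with u , u∈p , ter𝒲 ← cover p ab
    with terSet-removeW _≟_ ter𝒲
  ... | inj₂ ter′ = ⊥-elim (uncovered (u , u∈p , ter′))
  ... | inj₁ ter-Wᵢ = u , ter-Wᵢ , (i , ter-Wᵢ) , route r , starts r , subst B (sym (ends r)) p-B , only-u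
    where
    r : PathWithin (λ v → OnFin E v p) u (terF E p)
    r = suffix (whole p) u∈p

    only-u : ∀ w → OnFin E w (route r) → terSet E 𝒲 w → w ≡ u
    only-u w w∈r ter𝒲w with terSet-removeW _≟_ ter𝒲w
    ... | inj₁ ter-w = TerIs-functional (path 𝒲 i) ter-w ter-Wᵢ
    ... | inj₂ ter′  = ⊥-elim (uncovered (w , inside r w w∈r , ter′))

  ¬essential⇒wave : ExcludedMiddle 0ℓ → IsWave E A B 𝒲 → ¬ Essential E A B 𝒲 i →
                    IsWave E A B (removeW E 𝒲 i)
  ¬essential⇒wave em wave@(warp , inA , _) ¬essential =
    removeW-warp warp , removeW-in inA ,
    λ p ab → decidable-stable em (¬essential ∘ uncovered⇒essential (λ _ _ → em) wave p ab)

lemma3p4 : ExcludedMiddle 0ℓ → (Γ : Web) → let open Web Γ in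
           (𝒲 : Family E) → IsWave E A B 𝒲 → (i : Idx 𝒲) →
           Essential E A B 𝒲 i ⇔ (¬ IsWave E A B (removeW E 𝒲 i))
lemma3p4 em Γ 𝒲 wave i =
  mk⇔ (essential⇒¬wave (λ _ _ → em) wave)
      (λ ¬wave′ → decidable-stable em (¬wave′ ∘ ¬essential⇒wave em wave))
  where
  open Web Γ
  open WaveRemoval E A B 𝒲 i
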